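{- Let $n\ge 8$ be even. Let $v=(0,1,2,\dots,2,1)'\in\mathbb{R}^{n-1}$, $\widetilde{D}={\rm Circ}(v')$, and \[M := \begin{bmatrix} 0& \mathbf{1}' \\ \mathbf{1}& \widetilde{D} \end{bmatrix}\] (the distance matrix of the wheel graph $W_n$). Let $w:=\frac{1}{4}(5-n,1,\dots,1)'\in\mathbb{R}^n$, \[\widetilde{L} := \frac{n-1}{2}I_n - \frac{1}{2} \begin{bmatrix} 0 & \mathbf{1}' \\ \mathbf{1} & 0\end{bmatrix} + \sum_{k=1}^{\frac{n}{2}-1} (-1)^k \frac{(n-1)-2k}{2} \begin{bmatrix} 0 & 0 \\ 0 & C_k\end{bmatrix},\] and $Z := \begin{bmatrix} 2 \mathbf{1}' \\ \widetilde{D}+J\end{bmatrix}$ (an $n\times(n-1)$ matrix). Then: (i) $w'Z = \frac{n+3}{4}\mathbf{1}'$; (ii) $\widetilde{L}Z= \begin{bmatrix} \frac{5-n}{2}\mathbf{1}' \\ -2 I+ \frac{1}{2}J\end{bmatrix}$; (iii) $M^{ -1}Z = \begin{bmatrix} \frac{n-5}{4}\mathbf{1}' \\ I- \frac{1}{4}J\end{bmatrix} +\frac{n+3}{n-1}w\mathbf{1}'$; (iv) $Z'M^{ -1}Z = \widetilde{D}+\frac{2(n+1)}{n-1}J$.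
   Context: $\mathbf{1}$ is the all-ones vector in $\mathbb{R}^{n-1}$, $I$ and $J$ the $(n-1)\times(n-1)$ identity and all-ones matrices, $I_n$ the $n\times n$ identity. The vector $v$ has first entry $0$, second and last entries $1$, and all other entries $2$. For $s=(s_1,\dots,s_\mu)'$, ${\rm Circ}(s')$ is the $\mu\times\mu$ circulant matrix whose first row is $s'$ and each subsequent row is the cyclic right shift of the previous one. For $k\in\{1,\dots,\frac n2-1\}$, $c^k\in\mathbb{R}^{n-1}$ has $c^k_j=1$ if $j=k+1$ or $j=n-k$, and $c^k_j=0$ otherwise, and $C_k:={\rm Circ}({c^k}')$. (It is known that $M$ is invertible for even $n\ge4$.) -}

module Defs where

open import Data.Nat as ℕ using (ℕ; zero; suc; _∸_; _%_; _≡ᵇ_; NonZero)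
open import Data.Nat.DivMod using (m%n<n)
open import Data.Bool using (Bool; true; false; if_then_else_; _∨_)
open import Data.Fin using (Fin; toℕ; fromℕ<) renaming (zero to fz; suc to fs)
open import Data.Integer using (+_)
open import Data.Rational using (ℚ; 0ℚ; 1ℚ; _+_; _*_; _-_; -_; _/_)
open import Relation.Binary.PropositionalEquality using (_≡_)

ℕ→ℚ : ℕ → ℚ
ℕ→ℚ k = + k / 1

Mat : ℕ → ℕ → Set
Mat r c = Fin r → Fin c → ℚ

Vecℚ : ℕ → Set
Vecℚ r = Fin r → ℚ

sumFin : ∀ {r} → (Fin r → ℚ) → ℚ
sumFin {zero} f = 0ℚ
sumFin {suc r} f = f fz + sumFin (λ i → f (fs i))

_⊗_ : ∀ {a b c} → Mat a b → Mat b c → Mat a c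
(A ⊗ B) i j = sumFin (λ k → A i k * B k j)

_⊕_ : ∀ {a b} → Mat a b → Mat a b → Mat a b
(A ⊕ B) i j = A i j + B i j

_·_ : ∀ {a b} → ℚ → Mat a b → Mat a b
(s · A) i j = s * A i j

infixl 7 _⊗_
infixl 6 _⊕_
infixr 8 _·_

transpose : ∀ {a b} → Mat a b → Mat b a
transpose A i j = A j i

Id : ∀ {a} → Mat a a
Id {suc a} fz fz = 1ℚ
Id {suc a} fz (fs j) = 0ℚ
Id {suc a} (fs i) fz = 0ℚ
Id {suc a} (fs i) (fs j) = Id i j

Jm : ∀ {a b} → Mat a b
Jm i j = 1ℚ

ones : ∀ {a} → Vecℚ a
ones i = 1ℚ

col : ∀ {a} → Vecℚ a → Mat a 1
col x i j = x i

row : ∀ {a} → Vecℚ a → Mat 1 a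
row x i j = x j

_≈ₘ_ : ∀ {a b} → Mat a b → Mat a b → Set
A ≈ₘ B = ∀ i j → A i j ≡ B i j

block : ∀ {a b} → ℚ → Vecℚ b → Vecℚ a → Mat a b → Mat (suc a) (suc b)
block t r c B fz fz = t
block t r c B fz (fs j) = r j
block t r c B (fs i) fz = c i
block t r c B (fs i) (fs j) = B i j

stack : ∀ {a b} → Vecℚ b → Mat a b → Mat (suc a) b
stack r B fz j = r j
stack r B (fs i) j = B i j

circIdx : ∀ {μ} → Fin μ → Fin μ → Fin μ
circIdx {suc μ} a b = fromℕ< (m%n<n (suc μ ℕ.+ toℕ b ∸ toℕ a) (suc μ))

-- Circ(s'): first row s', each row the cyclic right shift of the previous one,
-- i.e. entry (a,b) = s_{(b-a) mod μ}
Circ : ∀ {μ} → Vecℚ μ → Mat μ μ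
Circ s a b = s (circIdx a b)

negOnePow : ℕ → ℚ
negOnePow zero = 1ℚ
negOnePow (suc k) = - negOnePow k

sumMat : ∀ {a b} → ℕ → (ℕ → Mat a b) → Mat a b
sumMat zero f i j = 0ℚ
sumMat (suc K) f = sumMat K f ⊕ f (suc K)

-- The objects of the theorem, parameterised by m = n - 1 (so n = suc m).
-- Indices j of ℝ^{n-1} are 0-based here: paper index j corresponds to toℕ j + 1.

vvec : (m : ℕ) → Vecℚ m
vvec m j = if toℕ j ≡ᵇ 0 then 0ℚ
           else if (toℕ j ≡ᵇ 1) ∨ (toℕ j ≡ᵇ (m ∸ 1)) then 1ℚ
           else ℕ→ℚ 2

Dt : (m : ℕ) → Mat m m
Dt m = Circ (vvec m)

Mmat : (m : ℕ) → Mat (suc m) (suc m)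
Mmat m = block 0ℚ ones ones (Dt m)

wvec : (m : ℕ) → Vecℚ (suc m)
wvec m fz = (+ 1 / 4) * (ℕ→ℚ 5 - ℕ→ℚ (suc m))
wvec m (fs j) = + 1 / 4

-- c^k: c^k_j = 1 iff j = k+1 or j = n-k (1-based), i.e. 0-based index k or n-1-k = m-k
ckvec : (m k : ℕ) → Vecℚ m
ckvec m k j = if (toℕ j ≡ᵇ k) ∨ (toℕ j ≡ᵇ (m ∸ k)) then 1ℚ else 0ℚ

Ck : (m k : ℕ) → Mat m m
Ck m k = Circ (ckvec m k)

Lt : (m : ℕ) → Mat (suc m) (suc m)
Lt m = ((ℕ→ℚ m * (+ 1 / 2)) · Id)
     ⊕ ((- (+ 1 / 2)) · block 0ℚ ones ones (λ _ _ → 0ℚ))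
     ⊕ sumMat (suc m ℕ./ 2 ∸ 1)
         (λ k → (negOnePow k * ((ℕ→ℚ m - ℕ→ℚ (2 ℕ.* k)) * (+ 1 / 2)))
                · block 0ℚ (λ _ → 0ℚ) (λ _ → 0ℚ) (Ck m k))

Zmat : (m : ℕ) → Mat (suc m) m
Zmat m = stack (λ _ → ℕ→ℚ 2) (Dt m ⊕ Jm)

module Submission where

-- Write Z = [2 1′; D̃ + J] and D̃ = 2J − 2I − C₁. Rows and columns of D̃ sum to 2(n − 3);
-- this gives (i) and M w = (n − 1)/4 · 1, hence M⁻¹ 1 = 4/(n − 1) · w. The columns of Z are
-- those of M (after the first) plus 1, so M⁻¹ Z = [0; I] + 4/(n − 1) · w 1′, which is (iii),
-- and (iv) follows from it, (i) and the symmetry of D̃.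
-- For (ii), C₁ C_k = C_{k−1} + C_{k+1} gives C_k (D̃ + J) = 6J − (C_{k−1} + 2C_k + C_{k+1}).
-- The coefficients s_k = (−1)^k (n − 1 − 2k)/2 satisfy s_k + 2s_{k+1} + s_{k+2} = 0, so
-- summation by parts collapses Σ_k s_k C_k (D̃ + J) to boundary terms; at the top end
-- n = 2h + 2 gives C_{h+1} = C_h and s_{h+1} = s_h, and the boundary terms cancel.


open import Defs
open import Data.Nat using (ℕ; suc; _≤_; NonZero)
open import Data.Nat.Divisibility using (_∣_)
open import Data.Integer using (+_)
open import Data.Rational using (ℚ; _*_; _-_; -_; _/_)
open import Data.Product using (_×_)

open import Algebra.Bundles using (CommutativeRing)
open import Data.Bool using (Bool; true; false; if_then_else_; _∨_; T)
open import Data.Empty using (⊥-elim)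
open import Data.Unit using (tt)
open import Data.Fin using (Fin; toℕ) renaming (zero to fz; suc to fs)
import Data.Fin.Properties as FinP
import Data.Integer as ℤ
import Data.Integer.Properties as ℤP
open import Data.Integer.Tactic.RingSolver as ℤ-Solver using ()
open import Data.Nat as ℕ using (zero; _≡ᵇ_; _%_; _∸_; _<_; z≤n; s≤s)
open import Data.Nat.DivMod using (%-remove-+ˡ; m%n%n≡m%n; [m+n]%n≡m%n; [m+kn]%n≡m%n; m%n<n; m<n⇒m%n≡m; %-distribˡ-+; m*n/n≡m)
open import Data.Nat.Divisibility using (divides; ∣-refl)
import Data.Nat.Properties as ℕP
open import Data.Nat.Tactic.RingSolver as ℕ-Solver using ()
open import Data.Product using (Σ-syntax; _,_)
open import Data.Rational using (0ℚ; 1ℚ; _+_; toℚᵘ)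
import Data.Rational.Properties as ℚP
open import Data.Rational.Unnormalised using (mkℚᵘ; *≡*) renaming (_+_ to _+ᵘ_; _*_ to _*ᵘ_; _≃_ to _≃ᵘ_)
import Data.Rational.Unnormalised.Properties as ℚᵘP
open import Function using (_∘_; mk⇔)
open import Level using (0ℓ)
open import Relation.Binary.PropositionalEquality
open import Relation.Nullary.Decidable using (does-⇔; dec⇒maybe)
open import Tactic.RingSolver using (solve-∀)
import Tactic.RingSolver.Core.AlmostCommutativeRing as ACR

open CommutativeRing ℚP.+-*-commutativeRing using (semiring)
open import Algebra.Properties.Semiring.Sum semiring
  using (sum; sum-cong-≗; ∑-distrib-+; ∑-comm; *-distribˡ-sum; *-distribʳ-sum)

ℚ-ring : ACR.AlmostCommutativeRing 0ℓ 0ℓ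
ℚ-ring = ACR.fromCommutativeRing ℚP.+-*-commutativeRing (λ x → dec⇒maybe (0ℚ ℚP.≟ x))

two ½ ¼ : ℚ
two = ℕ→ℚ 2
½ = + 1 / 2
¼ = + 1 / 4

toℚᵘ-/ : ∀ a d → toℚᵘ (+ a / suc d) ≃ᵘ mkℚᵘ (+ a) d
toℚᵘ-/ a d = ℚP.toℚᵘ-fromℚᵘ (mkℚᵘ (+ a) d)

ℕ→ℚ-+ : ∀ a b → ℕ→ℚ (a ℕ.+ b) ≡ ℕ→ℚ a + ℕ→ℚ b
ℕ→ℚ-+ a b = ℚP.toℚᵘ-injective (begin
  toℚᵘ (ℕ→ℚ (a ℕ.+ b))                ≈⟨ toℚᵘ-/ (a ℕ.+ b) 0 ⟩
  mkℚᵘ (+ (a ℕ.+ b)) 0                ≈⟨ *≡* (trans (cong (ℤ._* + 1) (ℤP.pos-+ a b)) (eq (+ a) (+ b))) ⟩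
  mkℚᵘ (+ a) 0 +ᵘ mkℚᵘ (+ b) 0        ≈⟨ ℚᵘP.+-cong (toℚᵘ-/ a 0) (toℚᵘ-/ b 0) ⟨
  toℚᵘ (ℕ→ℚ a) +ᵘ toℚᵘ (ℕ→ℚ b)        ≈⟨ ℚP.toℚᵘ-homo-+ (ℕ→ℚ a) (ℕ→ℚ b) ⟨
  toℚᵘ (ℕ→ℚ a + ℕ→ℚ b)                ∎)
  where
  open ℚᵘP.≃-Reasoning
  eq : ∀ x y → (x ℤ.+ y) ℤ.* + 1 ≡ (x ℤ.* + 1 ℤ.+ y ℤ.* + 1) ℤ.* + 1
  eq = ℤ-Solver.solve-∀

ℕ→ℚ-* : ∀ a b → ℕ→ℚ (a ℕ.* b) ≡ ℕ→ℚ a * ℕ→ℚ b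
ℕ→ℚ-* a b = ℚP.toℚᵘ-injective (begin
  toℚᵘ (ℕ→ℚ (a ℕ.* b))                ≈⟨ toℚᵘ-/ (a ℕ.* b) 0 ⟩
  mkℚᵘ (+ (a ℕ.* b)) 0                ≈⟨ *≡* (cong (ℤ._* + 1) (ℤP.pos-* a b)) ⟩
  mkℚᵘ (+ a) 0 *ᵘ mkℚᵘ (+ b) 0        ≈⟨ ℚᵘP.*-cong (toℚᵘ-/ a 0) (toℚᵘ-/ b 0) ⟨
  toℚᵘ (ℕ→ℚ a) *ᵘ toℚᵘ (ℕ→ℚ b)        ≈⟨ ℚP.toℚᵘ-homo-* (ℕ→ℚ a) (ℕ→ℚ b) ⟨
  toℚᵘ (ℕ→ℚ a * ℕ→ℚ b)                ∎)
  where open ℚᵘP.≃-Reasoning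

ℕ→ℚ-suc : ∀ a → ℕ→ℚ (suc a) ≡ 1ℚ + ℕ→ℚ a
ℕ→ℚ-suc = ℕ→ℚ-+ 1

/-as-* : ∀ a d → + a / suc d ≡ ℕ→ℚ a * (+ 1 / suc d)
/-as-* a d = ℚP.toℚᵘ-injective (begin
  toℚᵘ (+ a / suc d)                  ≈⟨ toℚᵘ-/ a d ⟩
  mkℚᵘ (+ a) d                        ≈⟨ *≡* (eq (+ a) (+ suc d)) ⟩
  mkℚᵘ (+ a) 0 *ᵘ mkℚᵘ (+ 1) d        ≈⟨ ℚᵘP.*-cong (toℚᵘ-/ a 0) (toℚᵘ-/ 1 d) ⟨
  toℚᵘ (ℕ→ℚ a) *ᵘ toℚᵘ (+ 1 / suc d)  ≈⟨ ℚP.toℚᵘ-homo-* (ℕ→ℚ a) (+ 1 / suc d) ⟨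
  toℚᵘ (ℕ→ℚ a * (+ 1 / suc d))        ∎)
  where
  open ℚᵘP.≃-Reasoning
  eq : ∀ x y → x ℤ.* (+ 1 ℤ.* y) ≡ (x ℤ.* + 1) ℤ.* y
  eq = ℤ-Solver.solve-∀

ℕ→ℚ-*-inverse : ∀ d → ℕ→ℚ (suc d) * (+ 1 / suc d) ≡ 1ℚ
ℕ→ℚ-*-inverse d = trans (sym (/-as-* (suc d) d)) (ℚP.toℚᵘ-injective (begin
  toℚᵘ (+ suc d / suc d)              ≈⟨ toℚᵘ-/ (suc d) d ⟩
  mkℚᵘ (+ suc d) d                    ≈⟨ *≡* (ℤP.*-comm (+ suc d) (+ 1)) ⟩
  toℚᵘ 1ℚ                             ∎))
  where open ℚᵘP.≃-Reasoning

-- Identities holding only modulo a vanishing z, such as (n − 1)·(1/(n − 1)) − 1, are proved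
-- as ring identities with an explicit multiple of z.
cancel-vanishing : ∀ {L R z : ℚ} (K : ℚ) → z ≡ 0ℚ → L ≡ R + z * K → L ≡ R
cancel-vanishing {R = R} K refl e = trans e (trans (cong (_+_ R) (ℚP.*-zeroˡ K)) (ℚP.+-identityʳ R))

cong₃ : ∀ {A B C D : Set} (f : A → B → C → D) {x x′ y y′ z z′} →
  x ≡ x′ → y ≡ y′ → z ≡ z′ → f x y z ≡ f x′ y′ z′
cong₃ f refl refl refl = refl

sumFin≡sum : ∀ {n} (f : Fin n → ℚ) → sumFin f ≡ sum f
sumFin≡sum {zero} f = refl
sumFin≡sum {suc n} f = cong (_+_ (f fz)) (sumFin≡sum (f ∘ fs))

sumFin-cong : ∀ {n} {f g : Fin n → ℚ} → (∀ i → f i ≡ g i) → sumFin f ≡ sumFin g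
sumFin-cong {f = f} {g} f≗g =
  trans (sumFin≡sum f) (trans (sum-cong-≗ f≗g) (sym (sumFin≡sum g)))

sumFin-+ : ∀ {n} (f g : Fin n → ℚ) → sumFin (λ i → f i + g i) ≡ sumFin f + sumFin g
sumFin-+ f g = trans (sumFin≡sum (λ i → f i + g i))
  (trans (∑-distrib-+ f g) (sym (cong₂ _+_ (sumFin≡sum f) (sumFin≡sum g))))

sumFin-*ˡ : ∀ {n} c (f : Fin n → ℚ) → sumFin (λ i → c * f i) ≡ c * sumFin f
sumFin-*ˡ c f = trans (sumFin≡sum (λ i → c * f i))
  (trans (sym (*-distribˡ-sum c f)) (cong (c *_) (sym (sumFin≡sum f))))

sumFin-*ʳ : ∀ {n} c (f : Fin n → ℚ) → sumFin (λ i → f i * c) ≡ sumFin f * c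
sumFin-*ʳ c f = trans (sumFin≡sum (λ i → f i * c))
  (trans (sym (*-distribʳ-sum c f)) (cong (_* c) (sym (sumFin≡sum f))))

sumFin-comm : ∀ {a b} (f : Fin a → Fin b → ℚ) →
  sumFin (λ i → sumFin (f i)) ≡ sumFin (λ j → sumFin (λ i → f i j))
sumFin-comm f = begin
  sumFin (λ i → sumFin (f i))              ≡⟨ sumFin-cong (λ i → sumFin≡sum (f i)) ⟩
  sumFin (λ i → sum (f i))                 ≡⟨ sumFin≡sum (λ i → sum (f i)) ⟩
  sum (λ i → sum (f i))                    ≡⟨ ∑-comm f ⟩
  sum (λ j → sum (λ i → f i j))            ≡⟨ sumFin≡sum (λ j → sum (λ i → f i j)) ⟨
  sumFin (λ j → sum (λ i → f i j))         ≡⟨ sumFin-cong (λ j → sumFin≡sum (λ i → f i j)) ⟨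
  sumFin (λ j → sumFin (λ i → f i j))      ∎
  where open ≡-Reasoning

sumFin-const : ∀ {n} c → sumFin {n} (λ _ → c) ≡ ℕ→ℚ n * c
sumFin-const {zero} c = sym (ℚP.*-zeroˡ c)
sumFin-const {suc n} c = begin
  c + sumFin {n} (λ _ → c)    ≡⟨ cong (_+_ c) (sumFin-const {n} c) ⟩
  c + ℕ→ℚ n * c               ≡⟨ factor c (ℕ→ℚ n) ⟩
  (1ℚ + ℕ→ℚ n) * c            ≡⟨ cong (_* c) (ℕ→ℚ-suc n) ⟨
  ℕ→ℚ (suc n) * c             ∎
  where
  open ≡-Reasoning
  factor : ∀ c x → c + x * c ≡ (1ℚ + x) * c
  factor = solve-∀ ℚ-ring

sumFin-Idˡ : ∀ {n} (i : Fin n) (f : Fin n → ℚ) → sumFin (λ k → Id i k * f k) ≡ f i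
sumFin-Idˡ {suc n} fz f = begin
  1ℚ * f fz + sumFin (λ k → 0ℚ * f (fs k))  ≡⟨ cong (_+_ (1ℚ * f fz)) (sumFin-*ˡ 0ℚ (f ∘ fs)) ⟩
  1ℚ * f fz + 0ℚ * sumFin (f ∘ fs)          ≡⟨ simplify (f fz) (sumFin (f ∘ fs)) ⟩
  f fz                                       ∎
  where
  open ≡-Reasoning
  simplify : ∀ a b → 1ℚ * a + 0ℚ * b ≡ a
  simplify = solve-∀ ℚ-ring
sumFin-Idˡ {suc n} (fs i) f =
  trans (cong (_+ sumFin (λ k → Id i k * f (fs k))) (ℚP.*-zeroˡ (f fz)))
        (trans (ℚP.+-identityˡ _) (sumFin-Idˡ i (f ∘ fs)))

sumFin-Idʳ : ∀ {n} (i : Fin n) (f : Fin n → ℚ) → sumFin (λ k → f k * Id k i) ≡ f i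
sumFin-Idʳ i f = trans (sumFin-cong (λ k → trans (ℚP.*-comm (f k) _) (cong (_* f k) (Id-sym k i))))
                       (sumFin-Idˡ i f)
  where
  Id-sym : ∀ {n} (k i : Fin n) → Id k i ≡ Id i k
  Id-sym fz fz = refl
  Id-sym fz (fs i) = refl
  Id-sym (fs k) fz = refl
  Id-sym (fs k) (fs i) = Id-sym k i

⊗-congˡ : ∀ {a b c} {A A′ : Mat a b} (B : Mat b c) → A ≈ₘ A′ → (A ⊗ B) ≈ₘ (A′ ⊗ B)
⊗-congˡ B A≈A′ i j = sumFin-cong (λ k → cong (_* B k j) (A≈A′ i k))

⊗-congʳ : ∀ {a b c} (A : Mat a b) {B B′ : Mat b c} → B ≈ₘ B′ → (A ⊗ B) ≈ₘ (A ⊗ B′)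
⊗-congʳ A B≈B′ i j = sumFin-cong (λ k → cong (A i k *_) (B≈B′ k j))

⊗-assoc : ∀ {a b c d} (A : Mat a b) (B : Mat b c) (C : Mat c d) → (A ⊗ B ⊗ C) ≈ₘ (A ⊗ (B ⊗ C))
⊗-assoc A B C i j = begin
  sumFin (λ k → sumFin (λ l → A i l * B l k) * C k j)
    ≡⟨ sumFin-cong (λ k → sym (sumFin-*ʳ (C k j) (λ l → A i l * B l k))) ⟩
  sumFin (λ k → sumFin (λ l → A i l * B l k * C k j))
    ≡⟨ sumFin-comm (λ k l → A i l * B l k * C k j) ⟩
  sumFin (λ l → sumFin (λ k → A i l * B l k * C k j))
    ≡⟨ sumFin-cong (λ l → trans (sumFin-cong (λ k → ℚP.*-assoc (A i l) (B l k) (C k j)))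
                                (sumFin-*ˡ (A i l) (λ k → B l k * C k j))) ⟩
  sumFin (λ l → A i l * sumFin (λ k → B l k * C k j))
    ∎
  where open ≡-Reasoning

⊗-distribˡ-⊕ : ∀ {a b c} (A : Mat a b) (B C : Mat b c) → (A ⊗ (B ⊕ C)) ≈ₘ (A ⊗ B ⊕ A ⊗ C)
⊗-distribˡ-⊕ A B C i j =
  trans (sumFin-cong (λ k → ℚP.*-distribˡ-+ (A i k) (B k j) (C k j)))
        (sumFin-+ (λ k → A i k * B k j) (λ k → A i k * C k j))

⊗-·ʳ : ∀ {a b c} (A : Mat a b) (s : ℚ) (B : Mat b c) → (A ⊗ s · B) ≈ₘ (s · (A ⊗ B))
⊗-·ʳ A s B i j =
  trans (sumFin-cong (λ k → swap (A i k) s (B k j))) (sumFin-*ˡ s (λ k → A i k * B k j))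
  where
  swap : ∀ a s b → a * (s * b) ≡ s * (a * b)
  swap = solve-∀ ℚ-ring

Id-⊗ : ∀ {a b} (A : Mat a b) → (Id ⊗ A) ≈ₘ A
Id-⊗ A i j = sumFin-Idˡ i (λ k → A k j)

left-inverse-solves : ∀ {a b} {N M : Mat a a} {X B : Mat a b} →
  (N ⊗ M) ≈ₘ Id → (M ⊗ X) ≈ₘ B → (N ⊗ B) ≈ₘ X
left-inverse-solves {N = N} {M} {X} {B} NM≈I MX≈B i j = begin
  (N ⊗ B) i j        ≡⟨ ⊗-congʳ N MX≈B i j ⟨
  (N ⊗ (M ⊗ X)) i j  ≡⟨ ⊗-assoc N M X i j ⟨
  (N ⊗ M ⊗ X) i j    ≡⟨ ⊗-congˡ X NM≈I i j ⟩
  (Id ⊗ X) i j       ≡⟨ Id-⊗ X i j ⟩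
  X i j              ∎
  where open ≡-Reasoning

sumFin-− : ∀ {n} (f g : Fin n → ℚ) → sumFin (λ i → f i - g i) ≡ sumFin f - sumFin g
sumFin-− {zero} f g = refl
sumFin-− {suc n} f g =
  trans (cong (_+_ (f fz - g fz)) (sumFin-− (f ∘ fs) (g ∘ fs)))
        (regroup (f fz) (g fz) (sumFin (f ∘ fs)) (sumFin (g ∘ fs)))
  where
  regroup : ∀ a b c d → a - b + (c - d) ≡ a + c - (b + d)
  regroup = solve-∀ ℚ-ring

𝟙 : Bool → ℚ
𝟙 b = if b then 1ℚ else 0ℚ

sumFin-𝟙-select : ∀ n c (g : ℕ → ℚ) → c < n → sumFin {n} (λ l → 𝟙 (toℕ l ≡ᵇ c) * g (toℕ l)) ≡ g c
sumFin-𝟙-select (suc n) zero g _ = begin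
  1ℚ * g 0 + sumFin {n} (λ l → 0ℚ * g (suc (toℕ l)))  ≡⟨ cong (_+_ (1ℚ * g 0)) (sumFin-*ˡ 0ℚ (g ∘ suc ∘ toℕ {n})) ⟩
  1ℚ * g 0 + 0ℚ * sumFin {n} (g ∘ suc ∘ toℕ)          ≡⟨ simplify (g 0) (sumFin {n} (g ∘ suc ∘ toℕ)) ⟩
  g 0                                                  ∎
  where
  open ≡-Reasoning
  simplify : ∀ a b → 1ℚ * a + 0ℚ * b ≡ a
  simplify = solve-∀ ℚ-ring
sumFin-𝟙-select (suc n) (suc c) g (s≤s c<n) =
  trans (cong (_+ sumFin {n} (λ l → 𝟙 (toℕ l ≡ᵇ c) * g (suc (toℕ l)))) (ℚP.*-zeroˡ (g 0)))
        (trans (ℚP.+-identityˡ _) (sumFin-𝟙-select n c (g ∘ suc) c<n))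

𝟙-∨ : ∀ t k k′ → k ≢ k′ → 𝟙 ((t ≡ᵇ k) ∨ (t ≡ᵇ k′)) ≡ 𝟙 (t ≡ᵇ k) + 𝟙 (t ≡ᵇ k′)
𝟙-∨ t k k′ k≢k′ with t ≡ᵇ k in t≡k | t ≡ᵇ k′ in t≡k′
... | true  | true  = ⊥-elim (k≢k′ (trans (sym (ℕP.≡ᵇ⇒≡ t k (subst T (sym t≡k) tt)))
                                          (ℕP.≡ᵇ⇒≡ t k′ (subst T (sym t≡k′) tt))))
... | true  | false = refl
... | false | true  = refl
... | false | false = refl

Id≡𝟙 : ∀ {n} (i j : Fin n) → Id i j ≡ 𝟙 (toℕ i ≡ᵇ toℕ j)
Id≡𝟙 fz fz = refl
Id≡𝟙 fz (fs j) = refl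
Id≡𝟙 (fs i) fz = refl
Id≡𝟙 (fs i) (fs j) = Id≡𝟙 i j

sum1to : ℕ → (ℕ → ℚ) → ℚ
sum1to zero g = 0ℚ
sum1to (suc K) g = sum1to K g + g (suc K)

sum1to-cong : ∀ K {f g : ℕ → ℚ} → (∀ k → k < K → f (suc k) ≡ g (suc k)) → sum1to K f ≡ sum1to K g
sum1to-cong zero f≗g = refl
sum1to-cong (suc K) f≗g =
  cong₂ _+_ (sum1to-cong K (λ k k<K → f≗g k (ℕP.m<n⇒m<1+n k<K))) (f≗g K ℕP.≤-refl)

sum1to-*-zero : ∀ K (f : ℕ → ℚ) → sum1to K (λ k → f k * 0ℚ) ≡ 0ℚ
sum1to-*-zero zero f = refl
sum1to-*-zero (suc K) f = cong₂ _+_ (sum1to-*-zero K f) (ℚP.*-zeroʳ (f (suc K)))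

sumMat-entry : ∀ {a b} K (f : ℕ → Mat a b) i j → sumMat K f i j ≡ sum1to K (λ k → f k i j)
sumMat-entry zero f i j = refl
sumMat-entry (suc K) f i j = cong (_+ f (suc K) i j) (sumMat-entry K f i j)

sumFin-sum1to : ∀ {n} K (f : ℕ → Fin n → ℚ) (g : Fin n → ℚ) →
  sumFin (λ b → sum1to K (λ k → f k b) * g b) ≡ sum1to K (λ k → sumFin (λ b → f k b * g b))
sumFin-sum1to {n} zero f g = trans (sumFin-cong (λ b → ℚP.*-zeroˡ (g b))) (trans (sumFin-const {n} 0ℚ) (ℚP.*-zeroʳ (ℕ→ℚ n)))
sumFin-sum1to (suc K) f g = begin
  sumFin (λ b → (sum1to K (λ k → f k b) + f (suc K) b) * g b)
    ≡⟨ sumFin-cong (λ b → ℚP.*-distribʳ-+ (g b) (sum1to K (λ k → f k b)) (f (suc K) b)) ⟩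
  sumFin (λ b → sum1to K (λ k → f k b) * g b + f (suc K) b * g b)
    ≡⟨ sumFin-+ (λ b → sum1to K (λ k → f k b) * g b) (λ b → f (suc K) b * g b) ⟩
  sumFin (λ b → sum1to K (λ k → f k b) * g b) + sumFin (λ b → f (suc K) b * g b)
    ≡⟨ cong (_+ sumFin (λ b → f (suc K) b * g b)) (sumFin-sum1to K f g) ⟩
  sum1to K (λ k → sumFin (λ b → f k b * g b)) + sumFin (λ b → f (suc K) b * g b)
    ∎
  where open ≡-Reasoning

summation-by-parts : (s E : ℕ → ℚ) (c : ℚ) → (∀ k → s k + two * s (suc k) + s (suc (suc k)) ≡ 0ℚ) →
  ∀ K → sum1to K (λ k → s k * (c - (E (k ∸ 1) + two * E k + E (suc k))))
      ≡ c * sum1to K s - (s 1 * E 0 - s 0 * E 1 + s K * E (suc K) - s (suc K) * E K)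
summation-by-parts s E c recurrence zero = identity c (s 1) (E 0) (s 0) (E 1)
  where
  identity : ∀ c a b d e → 0ℚ ≡ c * 0ℚ - (a * b - d * e + d * e - a * b)
  identity = solve-∀ ℚ-ring
summation-by-parts s E c recurrence (suc K) = begin
  sum1to K (λ k → s k * (c - (E (k ∸ 1) + two * E k + E (suc k)))) + s (suc K) * (c - (E K + two * E (suc K) + E (suc (suc K))))
    ≡⟨ cong (_+ s (suc K) * (c - (E K + two * E (suc K) + E (suc (suc K))))) (summation-by-parts s E c recurrence K) ⟩
  c * sum1to K s - (s 1 * E 0 - s 0 * E 1 + s K * E (suc K) - s (suc K) * E K)
    + s (suc K) * (c - (E K + two * E (suc K) + E (suc (suc K))))
    ≡⟨ cancel-vanishing (- E (suc K)) (recurrence K)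
         (identity c (sum1to K s) (s 0) (s 1) (E 0) (E 1) (s K) (s (suc K)) (s (suc (suc K))) (E K) (E (suc K)) (E (suc (suc K)))) ⟩
  c * (sum1to K s + s (suc K)) - (s 1 * E 0 - s 0 * E 1 + s (suc K) * E (suc (suc K)) - s (suc (suc K)) * E (suc K))
    ∎
  where
  open ≡-Reasoning
  identity : ∀ c S s₀ s₁ e₀ e₁ t₀ t₁ t₂ f₀ f₁ f₂ →
    c * S - (s₁ * e₀ - s₀ * e₁ + t₀ * f₁ - t₁ * f₀) + t₁ * (c - (f₀ + two * f₁ + f₂))
      ≡ c * (S + t₁) - (s₁ * e₀ - s₀ * e₁ + t₁ * f₂ - t₂ * f₁) + (t₀ + two * t₁ + t₂) * (- f₁)
  identity = solve-∀ ℚ-ring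

alternating : ℚ → ℕ → ℚ
alternating c k = negOnePow k * (c - ℕ→ℚ k)

alternating-recurrence : ∀ c k →
  alternating c k + two * alternating c (suc k) + alternating c (suc (suc k)) ≡ 0ℚ
alternating-recurrence c k = begin
  p * (c - K) + two * (- p * (c - ℕ→ℚ (suc k))) + - - p * (c - ℕ→ℚ (2 ℕ.+ k))
    ≡⟨ cong₂ (λ u v → p * (c - K) + two * (- p * (c - u)) + - - p * (c - v)) (ℕ→ℚ-suc k) (ℕ→ℚ-+ 2 k) ⟩
  p * (c - K) + two * (- p * (c - (1ℚ + K))) + - - p * (c - (two + K))
    ≡⟨ identity p c K ⟩
  0ℚ
    ∎
  where
  open ≡-Reasoning
  p K : ℚ
  p = negOnePow k
  K = ℕ→ℚ k
  identity : ∀ p c K → p * (c - K) + two * (- p * (c - (1ℚ + K))) + - - p * (c - (two + K)) ≡ 0ℚ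
  identity = solve-∀ ℚ-ring

module Residues (m′ : ℕ) where

  m : ℕ
  m = suc m′

  infix 4 _≡ₘ_
  _≡ₘ_ : ℕ → ℕ → Bool
  x ≡ₘ y = x % m ≡ᵇ y % m

  ≡ₘ-sym : ∀ x y → (x ≡ₘ y) ≡ (y ≡ₘ x)
  ≡ₘ-sym x y = does-⇔ (mk⇔ sym sym) (x % m ℕ.≟ y % m) (y % m ℕ.≟ x % m)

  ≡ₘ-respˡ : ∀ x x′ y → x % m ≡ x′ % m → (x ≡ₘ y) ≡ (x′ ≡ₘ y)
  ≡ₘ-respˡ x x′ y e = cong (_≡ᵇ y % m) e

  ≡ₘ-respʳ : ∀ x y y′ → y % m ≡ y′ % m → (x ≡ₘ y) ≡ (x ≡ₘ y′)
  ≡ₘ-respʳ x y y′ e = cong (x % m ≡ᵇ_) e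

  %-resp-+ʳ : ∀ x x′ z → x % m ≡ x′ % m → (x ℕ.+ z) % m ≡ (x′ ℕ.+ z) % m
  %-resp-+ʳ x x′ z e = begin
    (x ℕ.+ z) % m                ≡⟨ %-distribˡ-+ x z m ⟩
    (x % m ℕ.+ z % m) % m        ≡⟨ cong (λ r → (r ℕ.+ z % m) % m) e ⟩
    (x′ % m ℕ.+ z % m) % m       ≡⟨ %-distribˡ-+ x′ z m ⟨
    (x′ ℕ.+ z) % m               ∎
    where open ≡-Reasoning

  %-resp-+ˡ : ∀ z x x′ → x % m ≡ x′ % m → (z ℕ.+ x) % m ≡ (z ℕ.+ x′) % m
  %-resp-+ˡ z x x′ e =
    trans (cong (_% m) (ℕP.+-comm z x)) (trans (%-resp-+ʳ x x′ z e) (cong (_% m) (ℕP.+-comm x′ z)))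

  %-cancel-+ʳ : ∀ x y z → (x ℕ.+ z) % m ≡ (y ℕ.+ z) % m → x % m ≡ y % m
  %-cancel-+ʳ x y z e = begin
    x % m                        ≡⟨ [m+kn]%n≡m%n x z m ⟨
    (x ℕ.+ z ℕ.* m) % m          ≡⟨ cong (_% m) (regroup x) ⟩
    (x ℕ.+ z ℕ.+ z ℕ.* m′) % m   ≡⟨ %-resp-+ʳ (x ℕ.+ z) (y ℕ.+ z) (z ℕ.* m′) e ⟩
    (y ℕ.+ z ℕ.+ z ℕ.* m′) % m   ≡⟨ cong (_% m) (regroup y) ⟨
    (y ℕ.+ z ℕ.* m) % m          ≡⟨ [m+kn]%n≡m%n y z m ⟩
    y % m                        ∎
    where
    open ≡-Reasoning
    regroup : ∀ u → u ℕ.+ z ℕ.* m ≡ u ℕ.+ z ℕ.+ z ℕ.* m′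
    regroup u = trans (cong (u ℕ.+_) (ℕP.*-suc z m′)) (sym (ℕP.+-assoc u z (z ℕ.* m′)))

  ≡ₘ-cancel-+ʳ : ∀ x y z → (x ℕ.+ z ≡ₘ y ℕ.+ z) ≡ (x ≡ₘ y)
  ≡ₘ-cancel-+ʳ x y z = does-⇔ (mk⇔ (%-cancel-+ʳ x y z) (%-resp-+ʳ x y z)) (_ ℕ.≟ _) (_ ℕ.≟ _)

  sumFin-𝟙-≡ₘ : ∀ c (g : ℕ → ℚ) → sumFin {m} (λ l → 𝟙 (toℕ l ≡ₘ c) * g (toℕ l)) ≡ g (c % m)
  sumFin-𝟙-≡ₘ c g = trans
    (sumFin-cong {m} (λ l → cong (λ r → 𝟙 (r ≡ᵇ c % m) * g (toℕ l)) (m<n⇒m%n≡m (FinP.toℕ<n l))))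
    (sumFin-𝟙-select m (c % m) g (m%n<n c m))

  sumFin-𝟙-≡ₘ-one : ∀ c → sumFin {m} (λ l → 𝟙 (toℕ l ≡ₘ c)) ≡ 1ℚ
  sumFin-𝟙-≡ₘ-one c =
    trans (sumFin-cong {m} (λ l → sym (ℚP.*-identityʳ (𝟙 (toℕ l ≡ₘ c))))) (sumFin-𝟙-≡ₘ c (λ _ → 1ℚ))

  circIdx-≡ᵇ : (a b : Fin m) (c : ℕ) → c < m → (toℕ (circIdx a b) ≡ᵇ c) ≡ (toℕ b ≡ₘ c ℕ.+ toℕ a)
  circIdx-≡ᵇ a b c c<m = begin
    (toℕ (circIdx a b) ≡ᵇ c)              ≡⟨ cong₂ _≡ᵇ_ (FinP.toℕ-fromℕ< (m%n<n (m ℕ.+ toℕ b ∸ toℕ a) m))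
                                                          (sym (m<n⇒m%n≡m c<m)) ⟩
    (m ℕ.+ toℕ b ∸ toℕ a ≡ₘ c)            ≡⟨ ≡ₘ-cancel-+ʳ (m ℕ.+ toℕ b ∸ toℕ a) c (toℕ a) ⟨
    (m ℕ.+ toℕ b ∸ toℕ a ℕ.+ toℕ a ≡ₘ c ℕ.+ toℕ a)
      ≡⟨ cong (λ r → r % m ≡ᵇ (c ℕ.+ toℕ a) % m) (ℕP.m∸n+n≡m a≤m+b) ⟩
    (m ℕ.+ toℕ b ≡ₘ c ℕ.+ toℕ a)          ≡⟨ ≡ₘ-respˡ (m ℕ.+ toℕ b) (toℕ b) (c ℕ.+ toℕ a) (%-remove-+ˡ (toℕ b) {m} ∣-refl) ⟩
    (toℕ b ≡ₘ c ℕ.+ toℕ a)                ∎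
    where
    open ≡-Reasoning
    a≤m+b : toℕ a ℕ.≤ m ℕ.+ toℕ b
    a≤m+b = ℕP.≤-trans (ℕP.<⇒≤ (FinP.toℕ<n a)) (ℕP.m≤m+n m (toℕ b))

  ≡ₘ-pred : ∀ t c → (t ≡ₘ m′ ℕ.+ suc c) ≡ (t ≡ₘ c)
  ≡ₘ-pred t c = ≡ₘ-respʳ t (m′ ℕ.+ suc c) c
    (trans (cong (_% m) (trans (ℕP.+-comm m′ (suc c)) (sym (ℕP.+-suc c m′)))) ([m+n]%n≡m%n c m))

  Id≡𝟙-≡ₘ : (a j : Fin m) → Id a j ≡ 𝟙 (toℕ j ≡ₘ toℕ a)
  Id≡𝟙-≡ₘ a j = trans (Id≡𝟙 a j) (cong 𝟙 (trans
    (sym (cong₂ _≡ᵇ_ (m<n⇒m%n≡m (FinP.toℕ<n a)) (m<n⇒m%n≡m (FinP.toℕ<n j))))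
    (≡ₘ-sym (toℕ a) (toℕ j))))

  Ck-entry : ∀ k′ → suc k′ ℕ.+ suc k′ < m → (a b : Fin m) →
    Ck m (suc k′) a b ≡ 𝟙 (toℕ b ≡ₘ suc k′ ℕ.+ toℕ a) + 𝟙 (toℕ b ≡ₘ (m ∸ suc k′) ℕ.+ toℕ a)
  Ck-entry k′ 2k<m a b =
    trans (𝟙-∨ (toℕ (circIdx a b)) k (m ∸ k) k≢m∸k)
          (cong₂ (λ u v → 𝟙 u + 𝟙 v) (circIdx-≡ᵇ a b k k<m) (circIdx-≡ᵇ a b (m ∸ k) (s≤s (ℕP.m∸n≤m m′ k′))))
    where
    k : ℕ
    k = suc k′
    k<m : k < m
    k<m = ℕP.≤-<-trans (ℕP.m≤m+n k k) 2k<m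
    k≢m∸k : k ≢ m ∸ k
    k≢m∸k k≡m∸k = ℕP.<-irrefl (trans (cong (ℕ._+ k) k≡m∸k) (ℕP.m∸n+n≡m (ℕP.<⇒≤ k<m))) 2k<m

  Ck-apply : ∀ k′ → suc k′ ℕ.+ suc k′ < m → (a : Fin m) (g : ℕ → ℚ) →
    sumFin (λ b → Ck m (suc k′) a b * g (toℕ b))
      ≡ g ((suc k′ ℕ.+ toℕ a) % m) + g (((m ∸ suc k′) ℕ.+ toℕ a) % m)
  Ck-apply k′ 2k<m a g = begin
    sumFin (λ b → Ck m (suc k′) a b * g (toℕ b))
      ≡⟨ sumFin-cong (λ b → trans (cong (_* g (toℕ b)) (Ck-entry k′ 2k<m a b))
                                  (ℚP.*-distribʳ-+ (g (toℕ b)) (P b) (Q b))) ⟩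
    sumFin (λ b → P b * g (toℕ b) + Q b * g (toℕ b))
      ≡⟨ sumFin-+ (λ b → P b * g (toℕ b)) (λ b → Q b * g (toℕ b)) ⟩
    sumFin (λ b → P b * g (toℕ b)) + sumFin (λ b → Q b * g (toℕ b))
      ≡⟨ cong₂ _+_ (sumFin-𝟙-≡ₘ (suc k′ ℕ.+ toℕ a) g) (sumFin-𝟙-≡ₘ ((m ∸ suc k′) ℕ.+ toℕ a) g) ⟩
    g ((suc k′ ℕ.+ toℕ a) % m) + g (((m ∸ suc k′) ℕ.+ toℕ a) % m)
      ∎
    where
    open ≡-Reasoning
    P Q : Fin m → ℚ
    P b = 𝟙 (toℕ b ≡ₘ suc k′ ℕ.+ toℕ a)
    Q b = 𝟙 (toℕ b ≡ₘ (m ∸ suc k′) ℕ.+ toℕ a)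

vEntry : (atZero atOne atLast : Bool) → ℚ
vEntry p q r = two - two * 𝟙 p - 𝟙 q - 𝟙 r

vEntry-swap : ∀ p q r → vEntry p q r ≡ vEntry p r q
vEntry-swap p q r = swap two (𝟙 p) (𝟙 q) (𝟙 r)
  where
  swap : ∀ t a b c → t - t * a - b - c ≡ t - t * a - c - b
  swap = solve-∀ ℚ-ring

vvec-entry : ∀ t q → 2 ≤ q →
  (if t ≡ᵇ 0 then 0ℚ else if (t ≡ᵇ 1) ∨ (t ≡ᵇ q) then 1ℚ else two) ≡ vEntry (t ≡ᵇ 0) (t ≡ᵇ 1) (t ≡ᵇ q)
vvec-entry t (suc zero) (s≤s ())
vvec-entry zero (suc (suc q)) _ = refl
vvec-entry (suc zero) (suc (suc q)) _ = refl
vvec-entry (suc (suc t)) (suc (suc q)) _ with t ≡ᵇ q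
... | true  = refl
... | false = refl

module Wheel (m′ : ℕ) (2≤m′ : 2 ≤ m′) where

  open Residues m′ public

  x : ℚ
  x = ℕ→ℚ m

  -- D̃ = 2J − 2I − C₁, on residues mod n − 1.
  rimDist : ℕ → ℕ → ℚ
  rimDist a b = vEntry (b ≡ₘ a) (b ≡ₘ 1 ℕ.+ a) (b ≡ₘ m′ ℕ.+ a)

  Dt-entry : (a b : Fin m) → Dt m a b ≡ rimDist (toℕ a) (toℕ b)
  Dt-entry a b = trans (vvec-entry (toℕ (circIdx a b)) m′ 2≤m′)
    (cong₃ vEntry (circIdx-≡ᵇ a b 0 (s≤s z≤n))
                  (circIdx-≡ᵇ a b 1 (s≤s (ℕP.≤-trans (s≤s z≤n) 2≤m′)))
                  (circIdx-≡ᵇ a b m′ ℕP.≤-refl))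

  ≡ₘ-suc-swap : ∀ a b → (b ≡ₘ 1 ℕ.+ a) ≡ (a ≡ₘ m′ ℕ.+ b)
  ≡ₘ-suc-swap a b = begin
    (b ≡ₘ 1 ℕ.+ a)                 ≡⟨ ≡ₘ-cancel-+ʳ b (1 ℕ.+ a) m′ ⟨
    (b ℕ.+ m′ ≡ₘ 1 ℕ.+ a ℕ.+ m′)   ≡⟨ ≡ₘ-respʳ (b ℕ.+ m′) (1 ℕ.+ a ℕ.+ m′) a
                                        (trans (cong (_% m) (sym (ℕP.+-suc a m′))) ([m+n]%n≡m%n a m)) ⟩
    (b ℕ.+ m′ ≡ₘ a)                ≡⟨ ≡ₘ-sym (b ℕ.+ m′) a ⟩
    (a ≡ₘ b ℕ.+ m′)                ≡⟨ cong (a ≡ₘ_) (ℕP.+-comm b m′) ⟩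
    (a ≡ₘ m′ ℕ.+ b)                ∎
    where open ≡-Reasoning

  rimDist-sym : ∀ a b → rimDist a b ≡ rimDist b a
  rimDist-sym a b = trans
    (cong₃ vEntry (≡ₘ-sym b a) (≡ₘ-suc-swap a b) (sym (≡ₘ-suc-swap b a)))
    (vEntry-swap (a ≡ₘ b) (a ≡ₘ m′ ℕ.+ b) (a ≡ₘ 1 ℕ.+ b))

  rimDist-rowSum : ∀ a → sumFin {m} (λ b → rimDist a (toℕ b)) ≡ two * (x - two)
  rimDist-rowSum a = begin
    sumFin (λ b → two - two * P b - Q b - R b)
      ≡⟨ sumFin-− (λ b → two - two * P b - Q b) R ⟩
    sumFin (λ b → two - two * P b - Q b) - sumFin R
      ≡⟨ cong (_- sumFin R) (sumFin-− (λ b → two - two * P b) Q) ⟩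
    sumFin (λ b → two - two * P b) - sumFin Q - sumFin R
      ≡⟨ cong (λ r → r - sumFin Q - sumFin R) (sumFin-− (λ _ → two) (λ b → two * P b)) ⟩
    sumFin {m} (λ _ → two) - sumFin (λ b → two * P b) - sumFin Q - sumFin R
      ≡⟨ cong₃ (λ r s t → r - s - sumFin Q - t) (sumFin-const {m} two)
               (trans (sumFin-*ˡ two P) (cong (two *_) (sumFin-𝟙-≡ₘ-one a)))
               (sumFin-𝟙-≡ₘ-one (m′ ℕ.+ a)) ⟩
    x * two - two * 1ℚ - sumFin Q - 1ℚ
      ≡⟨ cong (λ r → x * two - two * 1ℚ - r - 1ℚ) (sumFin-𝟙-≡ₘ-one (1 ℕ.+ a)) ⟩
    x * two - two * 1ℚ - 1ℚ - 1ℚ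
      ≡⟨ simplify x ⟩
    two * (x - two)
      ∎
    where
    open ≡-Reasoning
    P Q R : Fin m → ℚ
    P b = 𝟙 (toℕ b ≡ₘ a)
    Q b = 𝟙 (toℕ b ≡ₘ 1 ℕ.+ a)
    R b = 𝟙 (toℕ b ≡ₘ m′ ℕ.+ a)
    simplify : ∀ x → x * two - two * 1ℚ - 1ℚ - 1ℚ ≡ two * (x - two)
    simplify = solve-∀ ℚ-ring

  Dt-sym : (a b : Fin m) → Dt m a b ≡ Dt m b a
  Dt-sym a b = trans (Dt-entry a b) (trans (rimDist-sym (toℕ a) (toℕ b)) (sym (Dt-entry b a)))

  Dt-rowSum : (a : Fin m) → sumFin (Dt m a) ≡ two * (x - two)
  Dt-rowSum a = trans (sumFin-cong (Dt-entry a)) (rimDist-rowSum (toℕ a))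

  Dt-colSum : (b : Fin m) → sumFin (λ a → Dt m a b) ≡ two * (x - two)
  Dt-colSum b = trans (sumFin-cong (λ a → Dt-sym a b)) (Dt-rowSum b)

  y : ℚ
  y = + 1 / m

  x*y-1≡0 : x * y - 1ℚ ≡ 0ℚ
  x*y-1≡0 = cong (_- 1ℚ) (ℕ→ℚ-*-inverse m′)

  ℕ→ℚ-n : ℕ→ℚ (suc m) ≡ 1ℚ + x
  ℕ→ℚ-n = ℕ→ℚ-suc m

  ℕ→ℚ-n+3 : ℕ→ℚ (suc m ℕ.+ 3) ≡ 1ℚ + x + ℕ→ℚ 3
  ℕ→ℚ-n+3 = trans (ℕ→ℚ-+ (suc m) 3) (cong (_+ ℕ→ℚ 3) ℕ→ℚ-n)

  Zmat-colSum : (j : Fin m) → sumFin (λ a → Dt m a j + 1ℚ) ≡ two * (x - two) + x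
  Zmat-colSum j = trans (sumFin-+ (λ a → Dt m a j) (λ _ → 1ℚ))
    (cong₂ _+_ (Dt-colSum j) (trans (sumFin-const {m} 1ℚ) (ℚP.*-identityʳ x)))

  wᵀ⊗Zmat : (transpose (col (wvec m)) ⊗ Zmat m) ≈ₘ ((+ (suc m ℕ.+ 3) / 4) · row ones)
  wᵀ⊗Zmat fz j = begin
    wvec m fz * two + sumFin (λ a → ¼ * (Dt m a j + 1ℚ))
      ≡⟨ cong (_+_ (wvec m fz * two)) (trans (sumFin-*ˡ ¼ (λ a → Dt m a j + 1ℚ)) (cong (_*_ ¼) (Zmat-colSum j))) ⟩
    ¼ * (ℕ→ℚ 5 - ℕ→ℚ (suc m)) * two + ¼ * (two * (x - two) + x)
      ≡⟨ cong (λ n → ¼ * (ℕ→ℚ 5 - n) * two + ¼ * (two * (x - two) + x)) ℕ→ℚ-n ⟩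
    ¼ * (ℕ→ℚ 5 - (1ℚ + x)) * two + ¼ * (two * (x - two) + x)
      ≡⟨ simplify x ⟩
    (1ℚ + x + ℕ→ℚ 3) * ¼ * 1ℚ
      ≡⟨ cong (λ c → c * ¼ * 1ℚ) ℕ→ℚ-n+3 ⟨
    ℕ→ℚ (suc m ℕ.+ 3) * ¼ * 1ℚ
      ≡⟨ cong (_* 1ℚ) (/-as-* (suc m ℕ.+ 3) 3) ⟨
    (+ (suc m ℕ.+ 3) / 4) * 1ℚ
      ∎
    where
    open ≡-Reasoning
    simplify : ∀ x → ¼ * (ℕ→ℚ 5 - (1ℚ + x)) * two + ¼ * (two * (x - two) + x) ≡ (1ℚ + x + ℕ→ℚ 3) * ¼ * 1ℚ
    simplify = solve-∀ ℚ-ring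

  -- This is where w comes from.
  Mmat⊗w : (Mmat m ⊗ col (wvec m)) ≈ₘ ((x * ¼) · col ones)
  Mmat⊗w fz fz = begin
    0ℚ * wvec m fz + sumFin {m} (λ _ → 1ℚ * ¼)  ≡⟨ cong (_+_ (0ℚ * wvec m fz)) (sumFin-const {m} (1ℚ * ¼)) ⟩
    0ℚ * wvec m fz + x * (1ℚ * ¼)               ≡⟨ simplify (wvec m fz) x ⟩
    x * ¼ * 1ℚ                                   ∎
    where
    open ≡-Reasoning
    simplify : ∀ w x → 0ℚ * w + x * (1ℚ * ¼) ≡ x * ¼ * 1ℚ
    simplify = solve-∀ ℚ-ring
  Mmat⊗w (fs a) fz = begin
    1ℚ * wvec m fz + sumFin (λ b → Dt m a b * ¼)
      ≡⟨ cong (_+_ (1ℚ * wvec m fz)) (trans (sumFin-*ʳ ¼ (Dt m a)) (cong (_* ¼) (Dt-rowSum a))) ⟩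
    1ℚ * (¼ * (ℕ→ℚ 5 - ℕ→ℚ (suc m))) + two * (x - two) * ¼
      ≡⟨ cong (λ n → 1ℚ * (¼ * (ℕ→ℚ 5 - n)) + two * (x - two) * ¼) ℕ→ℚ-n ⟩
    1ℚ * (¼ * (ℕ→ℚ 5 - (1ℚ + x))) + two * (x - two) * ¼
      ≡⟨ simplify x ⟩
    x * ¼ * 1ℚ
      ∎
    where
    open ≡-Reasoning
    simplify : ∀ x → 1ℚ * (¼ * (ℕ→ℚ 5 - (1ℚ + x))) + two * (x - two) * ¼ ≡ x * ¼ * 1ℚ
    simplify = solve-∀ ℚ-ring

  module LeftInverse (N : Mat (suc m) (suc m)) (NM≈I : (N ⊗ Mmat m) ≈ₘ Id) where

    N⊗ones : (N ⊗ col ones) ≈ₘ ((ℕ→ℚ 4 * y) · col (wvec m))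
    N⊗ones = left-inverse-solves {N = N} {Mmat m} NM≈I Mmat⊗scaled-w
      where
      Mmat⊗scaled-w : (Mmat m ⊗ (ℕ→ℚ 4 * y) · col (wvec m)) ≈ₘ col ones
      Mmat⊗scaled-w i j = begin
        (Mmat m ⊗ (ℕ→ℚ 4 * y) · col (wvec m)) i j  ≡⟨ ⊗-·ʳ (Mmat m) (ℕ→ℚ 4 * y) (col (wvec m)) i j ⟩
        ℕ→ℚ 4 * y * (Mmat m ⊗ col (wvec m)) i j     ≡⟨ cong (_*_ (ℕ→ℚ 4 * y)) (Mmat⊗w i j) ⟩
        ℕ→ℚ 4 * y * (x * ¼ * 1ℚ)                    ≡⟨ cancel-vanishing 1ℚ x*y-1≡0 (identity x y) ⟩
        1ℚ                                           ∎
        where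
        open ≡-Reasoning
        identity : ∀ x y → ℕ→ℚ 4 * y * (x * ¼ * 1ℚ) ≡ 1ℚ + (x * y - 1ℚ) * 1ℚ
        identity = solve-∀ ℚ-ring

    N⊗Zmat : ∀ i j → (N ⊗ Zmat m) i j ≡ Id i (fs j) + ℕ→ℚ 4 * y * wvec m i
    N⊗Zmat i j = begin
      (N ⊗ Zmat m) i j                                 ≡⟨ ⊗-congʳ N Zmat-split i j ⟩
      (N ⊗ (Mmat-tail ⊕ Jm)) i j                       ≡⟨ ⊗-distribˡ-⊕ N Mmat-tail Jm i j ⟩
      (N ⊗ Mmat m) i (fs j) + (N ⊗ col ones) i fz      ≡⟨ cong₂ _+_ (NM≈I i (fs j)) (N⊗ones i fz) ⟩
      Id i (fs j) + ℕ→ℚ 4 * y * wvec m i               ∎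
      where
      open ≡-Reasoning
      Mmat-tail : Mat (suc m) m
      Mmat-tail k l = Mmat m k (fs l)
      Zmat-split : Zmat m ≈ₘ (Mmat-tail ⊕ Jm)
      Zmat-split fz l = refl
      Zmat-split (fs k) l = refl

    coeff-iii : + (suc m ℕ.+ 3) / m ≡ (1ℚ + x + ℕ→ℚ 3) * y
    coeff-iii = trans (/-as-* (suc m ℕ.+ 3) m′) (cong (_* y) ℕ→ℚ-n+3)

    coeff-iv : + (2 ℕ.* (suc m ℕ.+ 1)) / m ≡ two * (1ℚ + x + 1ℚ) * y
    coeff-iv = trans (/-as-* (2 ℕ.* (suc m ℕ.+ 1)) m′) (cong (_* y)
      (trans (ℕ→ℚ-* 2 (suc m ℕ.+ 1)) (cong (_*_ two) (trans (ℕ→ℚ-+ (suc m) 1) (cong (_+ 1ℚ) ℕ→ℚ-n)))))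

    N⊗Zmat-formula : (N ⊗ Zmat m) ≈ₘ (stack (λ _ → (ℕ→ℚ (suc m) - ℕ→ℚ 5) * ¼) (Id ⊕ (- ¼) · Jm)
                                      ⊕ (+ (suc m ℕ.+ 3) / m) · (col (wvec m) ⊗ row ones))
    N⊗Zmat-formula fz j = begin
      (N ⊗ Zmat m) fz j
        ≡⟨ N⊗Zmat fz j ⟩
      0ℚ + ℕ→ℚ 4 * y * (¼ * (ℕ→ℚ 5 - ℕ→ℚ (suc m)))
        ≡⟨ cong (λ n → 0ℚ + ℕ→ℚ 4 * y * (¼ * (ℕ→ℚ 5 - n))) ℕ→ℚ-n ⟩
      0ℚ + ℕ→ℚ 4 * y * (¼ * (ℕ→ℚ 5 - (1ℚ + x)))
        ≡⟨ cancel-vanishing ((x - ℕ→ℚ 4) * ¼) x*y-1≡0 (identity x y) ⟩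
      ((1ℚ + x) - ℕ→ℚ 5) * ¼ + (1ℚ + x + ℕ→ℚ 3) * y * (¼ * (ℕ→ℚ 5 - (1ℚ + x)) * 1ℚ + 0ℚ)
        ≡⟨ cong₂ (λ n c → (n - ℕ→ℚ 5) * ¼ + c * (¼ * (ℕ→ℚ 5 - n) * 1ℚ + 0ℚ)) ℕ→ℚ-n coeff-iii ⟨
      (ℕ→ℚ (suc m) - ℕ→ℚ 5) * ¼ + (+ (suc m ℕ.+ 3) / m) * (wvec m fz * 1ℚ + 0ℚ)
        ∎
      where
      open ≡-Reasoning
      identity : ∀ x y → 0ℚ + ℕ→ℚ 4 * y * (¼ * (ℕ→ℚ 5 - (1ℚ + x)))
        ≡ ((1ℚ + x) - ℕ→ℚ 5) * ¼ + (1ℚ + x + ℕ→ℚ 3) * y * (¼ * (ℕ→ℚ 5 - (1ℚ + x)) * 1ℚ + 0ℚ)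
          + (x * y - 1ℚ) * ((x - ℕ→ℚ 4) * ¼)
      identity = solve-∀ ℚ-ring
    N⊗Zmat-formula (fs a) j = begin
      (N ⊗ Zmat m) (fs a) j
        ≡⟨ N⊗Zmat (fs a) j ⟩
      Id a j + ℕ→ℚ 4 * y * ¼
        ≡⟨ cancel-vanishing (- ¼) x*y-1≡0 (identity (Id a j) x y) ⟩
      Id a j + (- ¼) * 1ℚ + (1ℚ + x + ℕ→ℚ 3) * y * (¼ * 1ℚ + 0ℚ)
        ≡⟨ cong (λ c → Id a j + (- ¼) * 1ℚ + c * (¼ * 1ℚ + 0ℚ)) coeff-iii ⟨
      Id a j + (- ¼) * 1ℚ + (+ (suc m ℕ.+ 3) / m) * (¼ * 1ℚ + 0ℚ)
        ∎
      where
      open ≡-Reasoning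
      identity : ∀ d x y → d + ℕ→ℚ 4 * y * ¼
        ≡ d + (- ¼) * 1ℚ + (1ℚ + x + ℕ→ℚ 3) * y * (¼ * 1ℚ + 0ℚ) + (x * y - 1ℚ) * (- ¼)
      identity = solve-∀ ℚ-ring

    Zmatᵀ⊗N⊗Zmat-formula : (transpose (Zmat m) ⊗ N ⊗ Zmat m) ≈ₘ (Dt m ⊕ (+ (2 ℕ.* (suc m ℕ.+ 1)) / m) · Jm)
    Zmatᵀ⊗N⊗Zmat-formula i j = begin
      (transpose (Zmat m) ⊗ N ⊗ Zmat m) i j
        ≡⟨ ⊗-assoc (transpose (Zmat m)) N (Zmat m) i j ⟩
      sumFin (λ l → Zmat m l i * (N ⊗ Zmat m) l j)
        ≡⟨ sumFin-cong (λ l → trans (cong (_*_ (Zmat m l i)) (N⊗Zmat l j)) (ℚP.*-distribˡ-+ (Zmat m l i) (Id l (fs j)) (c * wvec m l))) ⟩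
      sumFin (λ l → Zmat m l i * Id l (fs j) + Zmat m l i * (c * wvec m l))
        ≡⟨ sumFin-+ (λ l → Zmat m l i * Id l (fs j)) (λ l → Zmat m l i * (c * wvec m l)) ⟩
      sumFin (λ l → Zmat m l i * Id l (fs j)) + sumFin (λ l → Zmat m l i * (c * wvec m l))
        ≡⟨ cong₂ _+_ (sumFin-Idʳ (fs j) (λ l → Zmat m l i)) Zmatᵀ⊗scaled-w ⟩
      Dt m j i + 1ℚ + c * ((+ (suc m ℕ.+ 3) / 4) * 1ℚ)
        ≡⟨ cong₂ (λ d e → d + 1ℚ + c * (e * 1ℚ)) (Dt-sym j i) (trans (/-as-* (suc m ℕ.+ 3) 3) (cong (_* ¼) ℕ→ℚ-n+3)) ⟩
      Dt m i j + 1ℚ + c * ((1ℚ + x + ℕ→ℚ 3) * ¼ * 1ℚ)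
        ≡⟨ cancel-vanishing (- 1ℚ) x*y-1≡0 (identity (Dt m i j) x y) ⟩
      Dt m i j + two * (1ℚ + x + 1ℚ) * y * 1ℚ
        ≡⟨ cong (λ e → Dt m i j + e * 1ℚ) coeff-iv ⟨
      Dt m i j + (+ (2 ℕ.* (suc m ℕ.+ 1)) / m) * 1ℚ
        ∎
      where
      open ≡-Reasoning
      c : ℚ
      c = ℕ→ℚ 4 * y
      Zmatᵀ⊗scaled-w : sumFin (λ l → Zmat m l i * (c * wvec m l)) ≡ c * ((+ (suc m ℕ.+ 3) / 4) * 1ℚ)
      Zmatᵀ⊗scaled-w = begin
        sumFin (λ l → Zmat m l i * (c * wvec m l))  ≡⟨ sumFin-cong (λ l → rearrange (Zmat m l i) c (wvec m l)) ⟩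
        sumFin (λ l → c * (wvec m l * Zmat m l i))  ≡⟨ sumFin-*ˡ c (λ l → wvec m l * Zmat m l i) ⟩
        c * (transpose (col (wvec m)) ⊗ Zmat m) fz i ≡⟨ cong (_*_ c) (wᵀ⊗Zmat fz i) ⟩
        c * ((+ (suc m ℕ.+ 3) / 4) * 1ℚ)            ∎
        where
        rearrange : ∀ z c w → z * (c * w) ≡ c * (w * z)
        rearrange = solve-∀ ℚ-ring
      identity : ∀ d x y → d + 1ℚ + ℕ→ℚ 4 * y * ((1ℚ + x + ℕ→ℚ 3) * ¼ * 1ℚ)
        ≡ d + two * (1ℚ + x + 1ℚ) * y * 1ℚ + (x * y - 1ℚ) * (- 1ℚ)
      identity = solve-∀ ℚ-ring

module EvenWheel (h : ℕ) (1≤h : 1 ≤ h) where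

  open Wheel (h ℕ.+ h) (ℕP.+-mono-≤ 1≤h 1≤h) public

  s : ℕ → ℚ
  s k = negOnePow k * ((x - ℕ→ℚ (2 ℕ.* k)) * ½)

  s≡alternating : ∀ k → s k ≡ alternating (x * ½) k
  s≡alternating k = cong (negOnePow k *_)
    (trans (cong (λ e → (x - e) * ½) (ℕ→ℚ-* 2 k)) (halve x (ℕ→ℚ k)))
    where
    halve : ∀ x K → (x - two * K) * ½ ≡ x * ½ - K
    halve = solve-∀ ℚ-ring

  s-recurrence : ∀ k → s k + two * s (suc k) + s (suc (suc k)) ≡ 0ℚ
  s-recurrence k = trans
    (cong₃ (λ a b c → a + two * b + c) (s≡alternating k) (s≡alternating (suc k)) (s≡alternating (suc (suc k))))
    (alternating-recurrence (x * ½) k)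

  x≡1+2h : x ≡ 1ℚ + (ℕ→ℚ h + ℕ→ℚ h)
  x≡1+2h = trans (ℕ→ℚ-suc (h ℕ.+ h)) (cong (_+_ 1ℚ) (ℕ→ℚ-+ h h))

  s-last : s (suc h) ≡ s h
  s-last = begin
    s (suc h)                                           ≡⟨ s≡alternating (suc h) ⟩
    - p * (x * ½ - ℕ→ℚ (suc h))                         ≡⟨ cong₂ (λ u v → - p * (u * ½ - v)) x≡1+2h (ℕ→ℚ-suc h) ⟩
    - p * ((1ℚ + (H + H)) * ½ - (1ℚ + H))               ≡⟨ identity p H ⟩
    p * ((1ℚ + (H + H)) * ½ - H)                        ≡⟨ cong (λ u → p * (u * ½ - H)) x≡1+2h ⟨
    p * (x * ½ - H)                                     ≡⟨ s≡alternating h ⟨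
    s h                                                 ∎
    where
    open ≡-Reasoning
    p H : ℚ
    p = negOnePow h
    H = ℕ→ℚ h
    identity : ∀ p H → - p * ((1ℚ + (H + H)) * ½ - (1ℚ + H)) ≡ p * ((1ℚ + (H + H)) * ½ - H)
    identity = solve-∀ ℚ-ring

  sum-s : sum1to h s ≡ (1ℚ - x) * ¼
  sum-s = cancel-vanishing ¼ boundary-identity (identity x (sum1to h s) (s h))
    where
    boundary-identity : ℕ→ℚ 4 * sum1to h s - (s 1 * 1ℚ - s 0 * 1ℚ + s h * 1ℚ - s h * 1ℚ) ≡ 0ℚ
    boundary-identity = trans
      (cong (λ t → ℕ→ℚ 4 * sum1to h s - (s 1 * 1ℚ - s 0 * 1ℚ + s h * 1ℚ - t * 1ℚ)) (sym s-last))
      (trans (sym (summation-by-parts s (λ _ → 1ℚ) (ℕ→ℚ 4) s-recurrence h)) (sum1to-*-zero h s))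
    identity : ∀ x S t → S ≡ (1ℚ - x) * ¼
      + (ℕ→ℚ 4 * S - ((- 1ℚ) * ((x - two) * ½) * 1ℚ - 1ℚ * ((x - 0ℚ) * ½) * 1ℚ + t * 1ℚ - t * 1ℚ)) * ¼
    identity = solve-∀ ℚ-ring

  K≡h : suc m ℕ./ 2 ∸ 1 ≡ h
  K≡h = trans (cong (λ n → n ℕ./ 2 ∸ 1) (suc-suc-double h)) (cong (_∸ 1) (m*n/n≡m (suc h) 2))
    where
    suc-suc-double : ∀ h → suc (suc (h ℕ.+ h)) ≡ suc h ℕ.* 2
    suc-suc-double = ℕ-Solver.solve-∀

  Lrim : Mat m m
  Lrim a b = x * ½ * Id a b + sum1to h (λ k → s k * Ck m k a b)

  Lt-block : Lt m ≈ₘ block (x * ½) (λ _ → - ½) (λ _ → - ½) Lrim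
  Lt-block i j = trans (cong (_+_ (x * ½ * Id i j + (- ½) * block 0ℚ ones ones (λ _ _ → 0ℚ) i j))
                             (trans (sumMat-entry (suc m ℕ./ 2 ∸ 1) F i j) (cong (λ K → sum1to K (λ k → F k i j)) K≡h)))
                       (entry i j)
    where
    F : ℕ → Mat (suc m) (suc m)
    F k = s k · block 0ℚ (λ _ → 0ℚ) (λ _ → 0ℚ) (Ck m k)
    off-rim : ∀ d → d + sum1to h (λ k → s k * 0ℚ) ≡ d
    off-rim d = trans (cong (_+_ d) (sum1to-*-zero h s)) (ℚP.+-identityʳ d)
    identity₁ : ∀ x → x * ½ * 1ℚ + (- ½) * 0ℚ ≡ x * ½
    identity₁ = solve-∀ ℚ-ring
    identity₂ : ∀ x → x * ½ * 0ℚ + (- ½) * 1ℚ ≡ - ½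
    identity₂ = solve-∀ ℚ-ring
    identity₃ : ∀ x d → x * ½ * d + (- ½) * 0ℚ ≡ x * ½ * d
    identity₃ = solve-∀ ℚ-ring
    entry : ∀ i j → x * ½ * Id i j + (- ½) * block 0ℚ ones ones (λ _ _ → 0ℚ) i j + sum1to h (λ k → F k i j)
                    ≡ block (x * ½) (λ _ → - ½) (λ _ → - ½) Lrim i j
    entry fz fz = trans (off-rim (x * ½ * 1ℚ + (- ½) * 0ℚ)) (identity₁ x)
    entry fz (fs b) = trans (off-rim (x * ½ * 0ℚ + (- ½) * 1ℚ)) (identity₂ x)
    entry (fs a) fz = trans (off-rim (x * ½ * 0ℚ + (- ½) * 1ℚ)) (identity₂ x)
    entry (fs a) (fs b) = cong (_+ sum1to h (λ k → s k * Ck m k a b)) (identity₃ x (Id a b))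

  top-row : ∀ j → (block (x * ½) (λ _ → - ½) (λ _ → - ½) Lrim ⊗ Zmat m) fz j ≡ (ℕ→ℚ 5 - ℕ→ℚ (suc m)) * ½
  top-row j = begin
    x * ½ * two + sumFin (λ b → (- ½) * (Dt m b j + 1ℚ))
      ≡⟨ cong (_+_ (x * ½ * two)) (trans (sumFin-*ˡ (- ½) (λ b → Dt m b j + 1ℚ)) (cong (_*_ (- ½)) (Zmat-colSum j))) ⟩
    x * ½ * two + (- ½) * (two * (x - two) + x)
      ≡⟨ identity x ⟩
    (ℕ→ℚ 5 - (1ℚ + x)) * ½
      ≡⟨ cong (λ n → (ℕ→ℚ 5 - n) * ½) ℕ→ℚ-n ⟨
    (ℕ→ℚ 5 - ℕ→ℚ (suc m)) * ½
      ∎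
    where
    open ≡-Reasoning
    identity : ∀ x → x * ½ * two + (- ½) * (two * (x - two) + x) ≡ (ℕ→ℚ 5 - (1ℚ + x)) * ½
    identity = solve-∀ ℚ-ring

  module Row (a j : Fin m) where

    â ĵ : ℕ
    â = toℕ a
    ĵ = toℕ j

    P : ℕ → ℚ
    P c = 𝟙 (ĵ ≡ₘ c ℕ.+ â)

    -- The (a, j) entry of C_c for 0 < c < n − 1, and of 2I for c = 0.
    E : ℕ → ℚ
    E c = P c + P (m ∸ c)

    Zcol : ℕ → ℚ
    Zcol t = rimDist t ĵ + 1ℚ

    Zcol-% : ∀ t → Zcol (t % m) ≡ Zcol t
    Zcol-% t = cong₃ (λ u v w → vEntry u v w + 1ℚ)
      (≡ₘ-respʳ ĵ (t % m) t t%m%m)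
      (≡ₘ-respʳ ĵ (1 ℕ.+ t % m) (1 ℕ.+ t) (%-resp-+ˡ 1 (t % m) t t%m%m))
      (≡ₘ-respʳ ĵ (h ℕ.+ h ℕ.+ t % m) (h ℕ.+ h ℕ.+ t) (%-resp-+ˡ (h ℕ.+ h) (t % m) t t%m%m))
      where
      t%m%m : t % m % m ≡ t % m
      t%m%m = m%n%n≡m%n t m

    -- Row a of C_k (D̃ + J) = 6J − (C_{k−1} + 2C_k + C_{k+1}), at column j.
    Zcol-pair : ∀ k′ → suc k′ ≤ h →
      Zcol (suc k′ ℕ.+ â) + Zcol ((m ∸ suc k′) ℕ.+ â) ≡ ℕ→ℚ 6 - (E k′ + two * E (suc k′) + E (suc (suc k′)))
    Zcol-pair k′ k≤h = trans
      (cong₃ (λ u v w → vEntry (ĵ ≡ₘ suc k′ ℕ.+ â) (ĵ ≡ₘ suc (suc k′) ℕ.+ â) u + 1ℚ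
                        + (vEntry (ĵ ≡ₘ (m ∸ suc k′) ℕ.+ â) v w + 1ℚ))
             (≡ₘ-pred ĵ (k′ ℕ.+ â))
             (cong (λ c → ĵ ≡ₘ c ℕ.+ â) (sym m∸k′))
             (trans (cong (λ c → ĵ ≡ₘ m′ ℕ.+ (c ℕ.+ â)) m′∸k′) (≡ₘ-pred ĵ ((m′ ∸ suc k′) ℕ.+ â))))
      (regroup (P (suc k′)) (P (suc (suc k′))) (P k′) (P (m ∸ suc k′)) (P (m ∸ k′)) (P (m ∸ suc (suc k′))))
      where
      m′ : ℕ
      m′ = h ℕ.+ h
      k<m′ : suc k′ ≤ m′
      k<m′ = ℕP.≤-trans k≤h (ℕP.m≤m+n h h)
      m∸k′ : m ∸ k′ ≡ suc (m′ ∸ k′)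
      m∸k′ = ℕP.+-∸-assoc 1 (ℕP.<⇒≤ k<m′)
      m′∸k′ : m′ ∸ k′ ≡ suc (m′ ∸ suc k′)
      m′∸k′ = ℕP.+-∸-assoc 1 k<m′
      regroup : ∀ A B C A′ B′ C′ → (two - two * A - B - C + 1ℚ) + (two - two * A′ - B′ - C′ + 1ℚ)
                                     ≡ ℕ→ℚ 6 - ((C + B′) + two * (A + A′) + (B + C′))
      regroup = solve-∀ ℚ-ring

    Ck⊗Zcol : ∀ k′ → suc k′ ≤ h →
      sumFin (λ b → Ck m (suc k′) a b * (Dt m b j + 1ℚ)) ≡ ℕ→ℚ 6 - (E k′ + two * E (suc k′) + E (suc (suc k′)))
    Ck⊗Zcol k′ k≤h = begin
      sumFin (λ b → Ck m (suc k′) a b * (Dt m b j + 1ℚ))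
        ≡⟨ sumFin-cong (λ b → cong (λ d → Ck m (suc k′) a b * (d + 1ℚ)) (Dt-entry b j)) ⟩
      sumFin (λ b → Ck m (suc k′) a b * Zcol (toℕ b))
        ≡⟨ Ck-apply k′ (s≤s (ℕP.+-mono-≤ k≤h k≤h)) a Zcol ⟩
      Zcol ((suc k′ ℕ.+ â) % m) + Zcol (((m ∸ suc k′) ℕ.+ â) % m)
        ≡⟨ cong₂ _+_ (Zcol-% (suc k′ ℕ.+ â)) (Zcol-% ((m ∸ suc k′) ℕ.+ â)) ⟩
      Zcol (suc k′ ℕ.+ â) + Zcol ((m ∸ suc k′) ℕ.+ â)
        ≡⟨ Zcol-pair k′ k≤h ⟩
      ℕ→ℚ 6 - (E k′ + two * E (suc k′) + E (suc (suc k′)))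
        ∎
      where open ≡-Reasoning

    Lrim⊗Zcol : sumFin (λ b → Lrim a b * (Dt m b j + 1ℚ))
      ≡ x * ½ * (Dt m a j + 1ℚ) + (ℕ→ℚ 6 * sum1to h s - (s 1 * E 0 - s 0 * E 1 + s h * E (suc h) - s (suc h) * E h))
    Lrim⊗Zcol = begin
      sumFin (λ b → (x * ½ * Id a b + C b) * G b)
        ≡⟨ sumFin-cong (λ b → ℚP.*-distribʳ-+ (G b) (x * ½ * Id a b) (C b)) ⟩
      sumFin (λ b → x * ½ * Id a b * G b + C b * G b)
        ≡⟨ sumFin-+ (λ b → x * ½ * Id a b * G b) (λ b → C b * G b) ⟩
      sumFin (λ b → x * ½ * Id a b * G b) + sumFin (λ b → C b * G b)
        ≡⟨ cong₂ _+_ scaled-Id (sumFin-sum1to h (λ k b → s k * Ck m k a b) G) ⟩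
      x * ½ * G a + sum1to h (λ k → sumFin (λ b → s k * Ck m k a b * G b))
        ≡⟨ cong (_+_ (x * ½ * G a)) (sum1to-cong h circulant-terms) ⟩
      x * ½ * G a + sum1to h (λ k → s k * (ℕ→ℚ 6 - (E (k ∸ 1) + two * E k + E (suc k))))
        ≡⟨ cong (_+_ (x * ½ * G a)) (summation-by-parts s E (ℕ→ℚ 6) s-recurrence h) ⟩
      x * ½ * G a + (ℕ→ℚ 6 * sum1to h s - (s 1 * E 0 - s 0 * E 1 + s h * E (suc h) - s (suc h) * E h))
        ∎
      where
      open ≡-Reasoning
      G C : Fin m → ℚ
      G b = Dt m b j + 1ℚ
      C b = sum1to h (λ k → s k * Ck m k a b)
      scaled-Id : sumFin (λ b → x * ½ * Id a b * G b) ≡ x * ½ * G a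
      scaled-Id = trans (sumFin-cong (λ b → ℚP.*-assoc (x * ½) (Id a b) (G b)))
                        (trans (sumFin-*ˡ (x * ½) (λ b → Id a b * G b)) (cong (_*_ (x * ½)) (sumFin-Idˡ a G)))
      circulant-terms : ∀ k′ → k′ < h → sumFin (λ b → s (suc k′) * Ck m (suc k′) a b * G b)
                          ≡ s (suc k′) * (ℕ→ℚ 6 - (E k′ + two * E (suc k′) + E (suc (suc k′))))
      circulant-terms k′ k≤h =
        trans (sumFin-cong (λ b → ℚP.*-assoc (s (suc k′)) (Ck m (suc k′) a b) (G b)))
              (trans (sumFin-*ˡ (s (suc k′)) (λ b → Ck m (suc k′) a b * G b)) (cong (_*_ (s (suc k′))) (Ck⊗Zcol k′ k≤h)))

    E-first : E 0 ≡ P 0 + P 0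
    E-first = cong (_+_ (P 0)) (cong 𝟙 (≡ₘ-respʳ ĵ (m ℕ.+ â) â (%-remove-+ˡ â {m} ∣-refl)))

    E-last : E (suc h) ≡ E h
    E-last = trans (cong (λ c → P (suc h) + P c) (ℕP.m+n∸n≡m h h))
                   (trans (ℚP.+-comm (P (suc h)) (P h)) (cong (λ c → P h + P c) (sym m∸h)))
      where
      m∸h : m ∸ h ≡ suc h
      m∸h = trans (ℕP.+-∸-assoc 1 (ℕP.m≤n+m h h)) (cong suc (ℕP.m+n∸n≡m h h))

    rim-row : (- ½) * two + sumFin (λ b → Lrim a b * (Dt m b j + 1ℚ)) ≡ (- two) * Id a j + ½ * 1ℚ
    rim-row = begin
      (- ½) * two + sumFin (λ b → Lrim a b * (Dt m b j + 1ℚ))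
        ≡⟨ cong (_+_ ((- ½) * two)) Lrim⊗Zcol ⟩
      (- ½) * two + (x * ½ * (Dt m a j + 1ℚ) + (ℕ→ℚ 6 * sum1to h s - (s 1 * E 0 - s 0 * E 1 + s h * E (suc h) - s (suc h) * E h)))
        ≡⟨ cong₃ (λ d S e → (- ½) * two + (x * ½ * (d + 1ℚ) + (ℕ→ℚ 6 * S - (s 1 * e - s 0 * E 1 + s h * E (suc h) - s (suc h) * E h))))
                 (Dt-entry a j) sum-s E-first ⟩
      (- ½) * two + (x * ½ * Zcol â + (ℕ→ℚ 6 * ((1ℚ - x) * ¼) - (s 1 * (P 0 + P 0) - s 0 * E 1 + s h * E (suc h) - s (suc h) * E h)))
        ≡⟨ cong₂ (λ e t → (- ½) * two + (x * ½ * Zcol â + (ℕ→ℚ 6 * ((1ℚ - x) * ¼) - (s 1 * (P 0 + P 0) - s 0 * E 1 + s h * e - t * E h))))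
                 E-last s-last ⟩
      (- ½) * two + (x * ½ * Zcol â + (ℕ→ℚ 6 * ((1ℚ - x) * ¼) - (s 1 * (P 0 + P 0) - s 0 * E 1 + s h * E h - s h * E h)))
        ≡⟨ identity x (P 0) (P 1) (P (h ℕ.+ h)) (E h) (s h) ⟩
      (- two) * P 0 + ½ * 1ℚ
        ≡⟨ cong (λ e → (- two) * e + ½ * 1ℚ) (Id≡𝟙-≡ₘ a j) ⟨
      (- two) * Id a j + ½ * 1ℚ
        ∎
      where
      open ≡-Reasoning
      identity : ∀ x P₀ P₁ Pₗ e t →
        (- ½) * two + (x * ½ * (two - two * P₀ - P₁ - Pₗ + 1ℚ)
          + (ℕ→ℚ 6 * ((1ℚ - x) * ¼) - ((- 1ℚ) * ((x - two) * ½) * (P₀ + P₀) - 1ℚ * ((x - 0ℚ) * ½) * (P₁ + Pₗ) + t * e - t * e)))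
        ≡ (- two) * P₀ + ½ * 1ℚ
      identity = solve-∀ ℚ-ring

  Lt⊗Zmat-formula : (Lt m ⊗ Zmat m) ≈ₘ stack (λ _ → (ℕ→ℚ 5 - ℕ→ℚ (suc m)) * ½) ((- ℕ→ℚ 2) · Id ⊕ ½ · Jm)
  Lt⊗Zmat-formula i j = trans (⊗-congˡ (Zmat m) Lt-block i j) (by-rows i j)
    where
    by-rows : ∀ i j → (block (x * ½) (λ _ → - ½) (λ _ → - ½) Lrim ⊗ Zmat m) i j
                ≡ stack (λ _ → (ℕ→ℚ 5 - ℕ→ℚ (suc m)) * ½) ((- ℕ→ℚ 2) · Id ⊕ ½ · Jm) i j
    by-rows fz j = top-row j
    by-rows (fs a) j = Row.rim-row a j

odd-as-double : ∀ m → 2 ∣ suc m → Σ[ h ∈ ℕ ] m ≡ suc (h ℕ.+ h)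
odd-as-double m (divides zero ())
odd-as-double m (divides (suc h) n≡2[h+1]) = h , ℕP.suc-injective (trans n≡2[h+1] (double h))
  where
  double : ∀ h → suc h ℕ.* 2 ≡ suc (suc (h ℕ.+ h))
  double = ℕ-Solver.solve-∀

mainTheorem8 : (m : ℕ) → {{_ : NonZero m}} → 8 ≤ suc m → 2 ∣ suc m →
  -- (i)  w' Z = (n+3)/4 1'
  ((transpose (col (wvec m)) ⊗ Zmat m) ≈ₘ ((+ (suc m Data.Nat.+ 3) / 4) · row ones))
  -- (ii) L~ Z = [ (5-n)/2 1' ; -2 I + 1/2 J ]
  × ((Lt m ⊗ Zmat m) ≈ₘ stack (λ _ → (ℕ→ℚ 5 - ℕ→ℚ (suc m)) * (+ 1 / 2))
                              ((- ℕ→ℚ 2) · Id Defs.⊕ (+ 1 / 2) · Jm))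
  -- (iii), (iv) for the inverse N = M⁻¹ of M
  × ((N : Mat (suc m) (suc m)) → (N ⊗ Mmat m) ≈ₘ Id → (Mmat m ⊗ N) ≈ₘ Id →
       ((N ⊗ Zmat m) ≈ₘ (stack (λ _ → (ℕ→ℚ (suc m) - ℕ→ℚ 5) * (+ 1 / 4))
                               (Id Defs.⊕ (- (+ 1 / 4)) · Jm)
                         Defs.⊕ (+ (suc m Data.Nat.+ 3) / m) · (col (wvec m) ⊗ row ones)))
       × ((transpose (Zmat m) ⊗ N ⊗ Zmat m) ≈ₘ
            (Dt m Defs.⊕ (+ (2 Data.Nat.* (suc m Data.Nat.+ 1)) / m) · Jm)))
mainTheorem8 m 8≤n 2∣n with odd-as-double m 2∣n
... | zero , refl with 8≤n
...   | s≤s (s≤s ())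
mainTheorem8 m 8≤n 2∣n | suc h , refl =
  wᵀ⊗Zmat , Lt⊗Zmat-formula ,
  λ N NM≈I _ → LeftInverse.N⊗Zmat-formula N NM≈I , LeftInverse.Zmatᵀ⊗N⊗Zmat-formula N NM≈I
  where open EvenWheel (suc h) (s≤s z≤n)
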